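{- Let $\delta \geq 4$ and let $c_0,c_1,c_2 \in \mathbb{Z}_\delta$. Then there exists a resolvable $3$-GDD of type $4^3$ with groups $G_j=\{i_j : i\in\{0,1,2,3\}\}$ for $j\in\{0,1,2\}$, together with a $\delta$-colouring in which vertex $i_j$ receives colour $c_j+i \pmod{\delta}$ for each $i\in\{0,1,2,3\}$ and $j\in\{0,1,2\}$. Moreover, if it is not the case that $c_0=c_1=c_2$, then $\{0_0,0_1,0_2\}$ is a block of this GDD.
   Context: A $3$-GDD is a triple $(V,\mathcal{G},\mathcal{B})$ where $\mathcal{G}$ partitions $V$ into groups and $\mathcal{B}$ is a set of $3$-subsets (blocks) such that every pair of points in different groups lies in exactly one block and no block meets a group in more than one point; type $4^3$ means three groups of size $4$. It is resolvable if $\mathcal{B}$ can be partitioned into parallel classes (sets of blocks partitioning $V$). A $\delta$-colouring is a map from the points to $\mathbb{Z}_\delta$ such that no block is monochromatic. -}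

module Defs where

open import Data.Nat using (ℕ; _%_; _+_; NonZero; _≤_; s≤s; z≤n; >-nonZero)
open import Data.Nat.Properties using (≤-trans)
open import Data.Fin using (Fin; toℕ)
import Data.Fin as Fin
open import Data.Product using (_×_; _,_; proj₁; proj₂)
open import Data.List using (List; length; filter; concat)
open import Data.List.Relation.Unary.All using (All)
open import Relation.Binary.PropositionalEquality using (_≡_; _≢_)
open import Relation.Nullary using (¬_; Dec)
open import Data.Sum using (_⊎_)
open import Data.Product.Properties using (≡-dec)
open import Data.Fin.Properties using () renaming (_≟_ to _≟F_)
open import Relation.Nullary.Decidable using (_⊎-dec_; _×-dec_)

-- Point i_j  is represented as (i , j) with i ∈ {0,1,2,3}, j ∈ {0,1,2}.
Point : Set
Point = Fin 4 × Fin 3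

grp : Point → Fin 3
grp = proj₂

record Block : Set where
  constructor blk
  field
    p₁ p₂ p₃ : Point
open Block public

_≟P_ : (x y : Point) → Dec (x ≡ y)
_≟P_ = ≡-dec _≟F_ _≟F_

_∈B_ : Point → Block → Set
x ∈B b = (x ≡ p₁ b) ⊎ (x ≡ p₂ b) ⊎ (x ≡ p₃ b)

_∈B?_ : (x : Point) → (b : Block) → Dec (x ∈B b)
x ∈B? b = (x ≟P p₁ b) ⊎-dec ((x ≟P p₂ b) ⊎-dec (x ≟P p₃ b))

-- a block meets each group in at most one point
-- (equivalently its three points lie in three distinct groups; in particular it is a 3-set)
Transversal : Block → Set
Transversal b = (grp (p₁ b) ≢ grp (p₂ b)) × (grp (p₁ b) ≢ grp (p₃ b)) × (grp (p₂ b) ≢ grp (p₃ b))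

countPt : Point → List Block → ℕ
countPt x bs = length (filter (λ b → x ∈B? b) bs)

countPair : Point → Point → List Block → ℕ
countPair x y bs = length (filter (λ b → (x ∈B? b) ×-dec (y ∈B? b)) bs)

IsParallelClass : List Block → Set
IsParallelClass bs = ∀ (x : Point) → countPt x bs ≡ 1

-- A resolvable 3-GDD of type 4^3 on the points i_j with groups G_j,
-- presented by its resolution: a list of parallel classes whose union is the block set.
record Resolvable3GDD : Set where
  field
    classes     : List (List Block)
    transversal : All Transversal (concat classes)
    pairs       : ∀ (x y : Point) → grp x ≢ grp y → countPair x y (concat classes) ≡ 1
    parallel    : All IsParallelClass classes
open Resolvable3GDD public

blocks : Resolvable3GDD → List Block
blocks D = concat (classes D)

-- the prescribed colouring: i_j ↦ c_j + i (mod δ)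
-- (colours are elements of ℤ_δ = {0,…,δ-1}, represented by naturals < δ)
colour : (δ : ℕ) → 4 ≤ δ → (Fin 3 → Fin δ) → Point → ℕ
colour δ h c (i , j) = _%_ (toℕ (c j) + toℕ i) δ {{>-nonZero (≤-trans (s≤s z≤n) h)}}

NotMono : (Point → ℕ) → Block → Set
NotMono f b = ¬ ((f (p₁ b) ≡ f (p₂ b)) × (f (p₂ b) ≡ f (p₃ b)))

IsColouring : (Point → ℕ) → List Block → Set
IsColouring f bs = All (NotMono f) bs

-- {0_0, 0_1, 0_2} is a block: some block has exactly these three points as a set
_∈Blocks_ : (Point × Point × Point) → List Block → Set
(x , y , z) ∈Blocks bs = Data.List.Relation.Unary.Any.Any
  (λ b → x ∈B b × y ∈B b × z ∈B b) bs
  where import Data.List.Relation.Unary.Any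

col3 : {δ : ℕ} → Fin δ → Fin δ → Fin δ → Fin 3 → Fin δ
col3 c₀ c₁ c₂ Fin.zero = c₀
col3 c₀ c₁ c₂ (Fin.suc Fin.zero) = c₁
col3 c₀ c₁ c₂ (Fin.suc (Fin.suc Fin.zero)) = c₂
  where import Data.Fin as Fin

-- The colours c₀ + a of a₀ and c₁ + b of b₁ agree iff c₀ + 3 ≡ c₁ + k (mod δ) for the
-- offset k = 3 + b − a ∈ {0, …, 6}; likewise for groups 0 and 2. So a colouring is seen
-- only through two profiles S₁, S₂ ⊆ {0, …, 6}, the offsets at which groups 0, 1 resp. 0, 2
-- agree, and as two offsets in one profile differ by a multiple of δ ≥ 4, the members of a
-- profile are at least 4 apart. For each of the finitely many such pairs of profiles, one of
-- five explicit resolvable TD(3,4)s has no block whose offsets lie in S₁ and S₂, and contains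
-- {0₀, 0₁, 0₂} unless 3 ∈ S₁ ∩ S₂, i.e. unless c₀ = c₁ = c₂; this is checked by evaluation.
module Submission where

open import Defs
open import Data.Nat using (ℕ; zero; suc; _+_; _∸_; _<_; _≤_; _%_; _<?_; _≤?_; NonZero; >-nonZero; >-nonZero⁻¹; s≤s; z≤n; _≟_)
open import Data.Nat.Properties using (≤-trans; +-mono-≤; +-monoʳ-≤; +-assoc; +-comm; +-suc; +-identityʳ; m∸n≤m; m+[n∸m]≡n; m<n⇒0<n∸m; m<n+o⇒m∸n<o; <⇒≤; <⇒≢; ≮⇒≥)
open import Data.Nat.DivMod using (%-distribˡ-+; %-congˡ; [m+n]%n≡m%n; m<n⇒m%n≡m)
open import Data.Fin using (Fin; zero; suc; toℕ; fromℕ<)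
open import Data.Fin.Patterns using (0F; 1F; 2F; 3F; 4F)
open import Data.Fin.Properties using (all?; any?; toℕ<n; toℕ≤pred[n]; toℕ-fromℕ<; toℕ-injective) renaming (_≟_ to _≟F_)
open import Data.Fin.Subset using (Subset; _∈_)
open import Data.Fin.Subset.Properties using (_∈?_; anySubset?)
open import Data.Vec.Properties using (lookup∘tabulate; []=⇒lookup; lookup⇒[]=)
open import Data.Vec using (tabulate)
open import Data.Bool using (true)
open import Data.Unit using (tt)
open import Data.Product using (Σ; ∃-syntax; _×_; _,_)
open import Data.Product.Properties using (≡-dec)
open import Data.Sum using (inj₁; inj₂)
open import Data.List using (List; []; _∷_; map; concat)
open import Data.List.Properties using (concat-map)
open import Data.List.Relation.Unary.All as All using (All)
open import Data.List.Relation.Unary.All.Properties as All using ()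
open import Data.List.Relation.Unary.Any as Any using (Any)
open import Data.List.Relation.Unary.Any.Properties as Any using ()
open import Data.List.Membership.Propositional using () renaming (_∈_ to _∈ₗ_)
import Data.List.Membership.DecPropositional as DecMembership
open import Function using (_∘_)
open import Relation.Binary.PropositionalEquality using (_≡_; _≢_; refl; sym; trans; cong; subst; module ≡-Reasoning)
open import Relation.Nullary using (¬_; Dec; does; proof; ¬?)
open import Relation.Nullary.Reflects using (Reflects; invert)
open import Relation.Nullary.Decidable using (_×-dec_; _→-dec_; toWitness; map′; decidable-stable; dec-true)
open import Relation.Unary using (Decidable)

open ≡-Reasoning

module _ {d : ℕ} .{{_ : NonZero d}} where

  %-+-congʳ : ∀ {m n} k → m % d ≡ n % d → (m + k) % d ≡ (n + k) % d
  %-+-congʳ {m} {n} k eq = begin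
    (m + k) % d           ≡⟨ %-distribˡ-+ m k d ⟩
    (m % d + k % d) % d   ≡⟨ cong (λ x → (x + k % d) % d) eq ⟩
    (n % d + k % d) % d   ≡⟨ %-distribˡ-+ n k d ⟨
    (n + k) % d           ∎

%-cancel-suc : ∀ {m n d} .{{_ : NonZero d}} → suc m % d ≡ suc n % d → m % d ≡ n % d
%-cancel-suc {m} {n} {d@(suc d-1)} eq = begin
  m % d              ≡⟨ [m+n]%n≡m%n m d ⟨
  (m + d) % d        ≡⟨ %-congˡ (+-suc m d-1) ⟩
  (suc m + d-1) % d  ≡⟨ %-+-congʳ {m = suc m} {n = suc n} d-1 eq ⟩
  (suc n + d-1) % d  ≡⟨ %-congˡ (+-suc n d-1) ⟨
  (n + d) % d        ≡⟨ [m+n]%n≡m%n n d ⟩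
  n % d              ∎

%-cancelˡ-+ : ∀ k {m n d} .{{_ : NonZero d}} → (k + m) % d ≡ (k + n) % d → m % d ≡ n % d
%-cancelˡ-+ zero    eq = eq
%-cancelˡ-+ (suc k) eq = %-cancelˡ-+ k (%-cancel-suc eq)

%-injective-window : ∀ m {i j d} .{{_ : NonZero d}} → i < j → j < i + d → (m + i) % d ≢ (m + j) % d
%-injective-window m {i} {j} {d} i<j j<i+d eq = <⇒≢ (m<n⇒0<n∸m i<j) (begin
  0              ≡⟨ m<n⇒m%n≡m (>-nonZero⁻¹ d) ⟨
  0 % d          ≡⟨ %-cancelˡ-+ (m + i) shifted ⟩
  (j ∸ i) % d    ≡⟨ m<n⇒m%n≡m (m<n+o⇒m∸n<o j i j<i+d) ⟩
  j ∸ i          ∎)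
  where
  shifted : (m + i + 0) % d ≡ (m + i + (j ∸ i)) % d
  shifted = begin
    (m + i + 0) % d        ≡⟨ %-congˡ (+-identityʳ (m + i)) ⟩
    (m + i) % d            ≡⟨ eq ⟩
    (m + j) % d            ≡⟨ %-congˡ (cong (m +_) (m+[n∸m]≡n (<⇒≤ i<j))) ⟨
    (m + (i + (j ∸ i))) % d ≡⟨ %-congˡ (+-assoc m i (j ∸ i)) ⟨
    (m + i + (j ∸ i)) % d  ∎

Sparse : ∀ {n} → ℕ → Subset n → Set
Sparse g S = ∀ i j → i ∈ S → j ∈ S → toℕ i < toℕ j → toℕ i + g ≤ toℕ j

sparse? : ∀ {n} g → Decidable (Sparse {n} g)
sparse? g S = all? λ i → all? λ j →
  (i ∈? S) →-dec ((j ∈? S) →-dec ((toℕ i <? toℕ j) →-dec (toℕ i + g ≤? toℕ j)))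

sparse-weaken : ∀ {n g g′} {S : Subset n} → g ≤ g′ → Sparse g′ S → Sparse g S
sparse-weaken g≤g′ sparse i j i∈S j∈S i<j = ≤-trans (+-monoʳ-≤ (toℕ i) g≤g′) (sparse i j i∈S j∈S i<j)

offset : Fin 4 → Fin 4 → Fin 7
offset a b = fromℕ< {toℕ b + (3 ∸ toℕ a)} (s≤s (+-mono-≤ (toℕ≤pred[n] b) (m∸n≤m 3 (toℕ a))))

module _ {d : ℕ} .{{_ : NonZero d}} where

  agree? : ∀ u v (k : Fin 7) → Dec ((u + 3) % d ≡ (v + toℕ k) % d)
  agree? u v k = (u + 3) % d ≟ (v + toℕ k) % d

  profile : ℕ → ℕ → Subset 7
  profile u v = tabulate (does ∘ agree? u v)

  ∈-profile⁺ : ∀ {u v} k → (u + 3) % d ≡ (v + toℕ k) % d → k ∈ profile u v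
  ∈-profile⁺ {u} {v} k eq =
    lookup⇒[]= k _ (trans (lookup∘tabulate (does ∘ agree? u v) k) (dec-true (agree? u v k) eq))

  ∈-profile⁻ : ∀ {u v} k → k ∈ profile u v → (u + 3) % d ≡ (v + toℕ k) % d
  ∈-profile⁻ {u} {v} k k∈ = invert (subst (Reflects _) agrees (proof (agree? u v k)))
    where
    agrees : does (agree? u v k) ≡ true
    agrees = trans (sym (lookup∘tabulate (does ∘ agree? u v) k)) ([]=⇒lookup k∈)

  offset-∈-profile : ∀ {u v} a b → (u + toℕ a) % d ≡ (v + toℕ b) % d → offset a b ∈ profile u v
  offset-∈-profile {u} {v} a b eq = ∈-profile⁺ (offset a b) (begin
    (u + 3) % d                    ≡⟨ %-congˡ (cong (u +_) (m+[n∸m]≡n (toℕ≤pred[n] a))) ⟨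
    (u + (toℕ a + (3 ∸ toℕ a))) % d ≡⟨ %-congˡ (+-assoc u (toℕ a) _) ⟨
    (u + toℕ a + (3 ∸ toℕ a)) % d   ≡⟨ %-+-congʳ (3 ∸ toℕ a) eq ⟩
    (v + toℕ b + (3 ∸ toℕ a)) % d   ≡⟨ %-congˡ (+-assoc v (toℕ b) _) ⟩
    (v + (toℕ b + (3 ∸ toℕ a))) % d ≡⟨ %-congˡ (cong (v +_) (toℕ-fromℕ< _)) ⟨
    (v + toℕ (offset a b)) % d      ∎)

  profile-sparse : ∀ u v → Sparse d (profile u v)
  profile-sparse u v i j i∈ j∈ i<j = ≮⇒≥ λ j<i+d →
    %-injective-window v i<j j<i+d (trans (sym (∈-profile⁻ i i∈)) (∈-profile⁻ j j∈))

  offset₀₀-∈-profile⇒≡ : (c c′ : Fin d) → offset 0F 0F ∈ profile (toℕ c) (toℕ c′) → c ≡ c′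
  offset₀₀-∈-profile⇒≡ c c′ k∈ = toℕ-injective (begin
    toℕ c      ≡⟨ m<n⇒m%n≡m (toℕ<n c) ⟨
    toℕ c % d  ≡⟨ %-cancelˡ-+ 3 (begin
                    (3 + toℕ c) % d   ≡⟨ %-congˡ (+-comm 3 (toℕ c)) ⟩
                    (toℕ c + 3) % d   ≡⟨ ∈-profile⁻ _ k∈ ⟩
                    (toℕ c′ + 3) % d  ≡⟨ %-congˡ (+-comm (toℕ c′) 3) ⟩
                    (3 + toℕ c′) % d  ∎) ⟩
    toℕ c′ % d ≡⟨ m<n⇒m%n≡m (toℕ<n c′) ⟩
    toℕ c′     ∎)

Triple : Set
Triple = Fin 4 × Fin 4 × Fin 4

toBlock : Triple → Block
toBlock (a , b , e) = blk (a , 0F) (b , 1F) (e , 2F)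

toBlock-transversal : ∀ t → Transversal (toBlock t)
toBlock-transversal t = (λ ()) , (λ ()) , (λ ())

∈B-toBlock : ∀ a b e → (a , 0F) ∈B toBlock (a , b , e) × (b , 1F) ∈B toBlock (a , b , e) × (e , 2F) ∈B toBlock (a , b , e)
∈B-toBlock a b e = inj₁ refl , inj₂ (inj₁ refl) , inj₂ (inj₂ refl)

Resolution : Set
Resolution = List (List Triple)

blocksOf : Resolution → List Block
blocksOf R = concat (map (map toBlock) R)

All-blocksOf : ∀ {P : Block → Set} R → All (P ∘ toBlock) (concat R) → All P (blocksOf R)
All-blocksOf {P} R all = subst (All P) (sym (concat-map R)) (All.map⁺ all)

Any-blocksOf : ∀ {P : Block → Set} R → Any (P ∘ toBlock) (concat R) → Any P (blocksOf R)
Any-blocksOf {P} R any = subst (Any P) (sym (concat-map R)) (Any.map⁺ any)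

IsResolution : Resolution → Set
IsResolution R =
  (∀ x y → grp x ≢ grp y → countPair x y (blocksOf R) ≡ 1) × All IsParallelClass (map (map toBlock) R)

allPoints? : ∀ {P : Point → Set} → Decidable P → Dec (∀ x → P x)
allPoints? P? = map′ (λ all (i , j) → all i j) (λ all i j → all (i , j)) (all? λ i → all? λ j → P? (i , j))

isResolution? : Decidable IsResolution
isResolution? R =
  allPoints? (λ x → allPoints? λ y → ¬? (grp x ≟F grp y) →-dec (countPair x y (blocksOf R) ≟ 1))
  ×-dec All.all? (λ C → allPoints? λ x → countPt x C ≟ 1) (map (map toBlock) R)

toGDD : ∀ R → IsResolution R → Resolvable3GDD
toGDD R (pairs-once , parallel-classes) = record
  { classes     = map (map toBlock) R
  ; transversal = All-blocksOf R (All.universal toBlock-transversal (concat R))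
  ; pairs       = pairs-once
  ; parallel    = parallel-classes
  }

resolution : Fin 5 → Resolution
resolution 0F =
  ((0F , 0F , 0F) ∷ (1F , 1F , 3F) ∷ (2F , 2F , 2F) ∷ (3F , 3F , 1F) ∷ []) ∷
  ((0F , 1F , 1F) ∷ (1F , 0F , 2F) ∷ (2F , 3F , 3F) ∷ (3F , 2F , 0F) ∷ []) ∷
  ((0F , 2F , 3F) ∷ (1F , 3F , 0F) ∷ (2F , 0F , 1F) ∷ (3F , 1F , 2F) ∷ []) ∷
  ((0F , 3F , 2F) ∷ (1F , 2F , 1F) ∷ (2F , 1F , 0F) ∷ (3F , 0F , 3F) ∷ []) ∷ []
resolution 1F =
  ((0F , 0F , 0F) ∷ (1F , 1F , 3F) ∷ (2F , 2F , 2F) ∷ (3F , 3F , 1F) ∷ []) ∷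
  ((0F , 1F , 2F) ∷ (1F , 0F , 1F) ∷ (2F , 3F , 0F) ∷ (3F , 2F , 3F) ∷ []) ∷
  ((0F , 2F , 1F) ∷ (1F , 3F , 2F) ∷ (2F , 0F , 3F) ∷ (3F , 1F , 0F) ∷ []) ∷
  ((0F , 3F , 3F) ∷ (1F , 2F , 0F) ∷ (2F , 1F , 1F) ∷ (3F , 0F , 2F) ∷ []) ∷ []
resolution 2F =
  ((0F , 0F , 0F) ∷ (1F , 1F , 2F) ∷ (2F , 2F , 1F) ∷ (3F , 3F , 3F) ∷ []) ∷
  ((0F , 1F , 1F) ∷ (1F , 0F , 3F) ∷ (2F , 3F , 0F) ∷ (3F , 2F , 2F) ∷ []) ∷
  ((0F , 2F , 3F) ∷ (1F , 3F , 1F) ∷ (2F , 0F , 2F) ∷ (3F , 1F , 0F) ∷ []) ∷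
  ((0F , 3F , 2F) ∷ (1F , 2F , 0F) ∷ (2F , 1F , 3F) ∷ (3F , 0F , 1F) ∷ []) ∷ []
resolution 3F =
  ((0F , 0F , 0F) ∷ (1F , 2F , 3F) ∷ (2F , 3F , 1F) ∷ (3F , 1F , 2F) ∷ []) ∷
  ((0F , 1F , 1F) ∷ (1F , 3F , 2F) ∷ (2F , 2F , 0F) ∷ (3F , 0F , 3F) ∷ []) ∷
  ((0F , 2F , 2F) ∷ (1F , 0F , 1F) ∷ (2F , 1F , 3F) ∷ (3F , 3F , 0F) ∷ []) ∷
  ((0F , 3F , 3F) ∷ (1F , 1F , 0F) ∷ (2F , 0F , 2F) ∷ (3F , 2F , 1F) ∷ []) ∷ []
resolution 4F =
  ((0F , 0F , 1F) ∷ (1F , 1F , 3F) ∷ (2F , 3F , 2F) ∷ (3F , 2F , 0F) ∷ []) ∷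
  ((0F , 1F , 0F) ∷ (1F , 0F , 2F) ∷ (2F , 2F , 3F) ∷ (3F , 3F , 1F) ∷ []) ∷
  ((0F , 2F , 2F) ∷ (1F , 3F , 0F) ∷ (2F , 1F , 1F) ∷ (3F , 0F , 3F) ∷ []) ∷
  ((0F , 3F , 3F) ∷ (1F , 2F , 1F) ∷ (2F , 0F , 0F) ∷ (3F , 1F , 2F) ∷ []) ∷ []

resolution-valid : ∀ k → IsResolution (resolution k)
resolution-valid = toWitness {a? = all? (isResolution? ∘ resolution)} tt

allSubsets? : ∀ {n} {P : Subset n → Set} → Decidable P → Dec (∀ S → P S)
allSubsets? P? = map′
  (λ ¬∃¬P S → decidable-stable (P? S) (λ ¬PS → ¬∃¬P (S , ¬PS)))
  (λ ∀P (S , ¬PS) → ¬PS (∀P S))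
  (¬? (anySubset? (¬? ∘ P?)))

Avoids : Subset 7 → Subset 7 → Triple → Set
Avoids S T (a , b , e) = ¬ (offset a b ∈ S × offset a e ∈ T)

avoids? : ∀ S T → Decidable (Avoids S T)
avoids? S T (a , b , e) = ¬? ((offset a b ∈? S) ×-dec (offset a e ∈? T))

_≟T_ : (s t : Triple) → Dec (s ≡ t)
_≟T_ = ≡-dec _≟F_ (≡-dec _≟F_ _≟F_)

open DecMembership _≟T_ using () renaming (_∈?_ to _∈ₗ?_)

Suits : Subset 7 → Subset 7 → Resolution → Set
Suits S T R = All (Avoids S T) (concat R) ×
  (¬ (offset 0F 0F ∈ S × offset 0F 0F ∈ T) → (0F , 0F , 0F) ∈ₗ concat R)

suits? : ∀ S T → Decidable (Suits S T)
suits? S T R = All.all? (avoids? S T) (concat R) ×-dec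
  (¬? ((offset 0F 0F ∈? S) ×-dec (offset 0F 0F ∈? T)) →-dec ((0F , 0F , 0F) ∈ₗ? concat R))

-- Opaque: otherwise later unification problems unfold the exhaustive check.
opaque
  sparse-profiles-suited : ∀ S → Sparse 4 S → ∀ T → Sparse 4 T → ∃[ k ] Suits S T (resolution k)
  sparse-profiles-suited = toWitness {a? =
    allSubsets? λ S → sparse? 4 S →-dec allSubsets? λ T → sparse? 4 T →-dec any? (suits? S T ∘ resolution)} tt

module Profiles {δ : ℕ} (h : 4 ≤ δ) (c₀ c₁ c₂ : Fin δ) where

  private instance
    δ≢0 : NonZero δ
    δ≢0 = >-nonZero (≤-trans (s≤s z≤n) h)

  S₁ S₂ : Subset 7
  S₁ = profile {δ} (toℕ c₀) (toℕ c₁)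
  S₂ = profile {δ} (toℕ c₀) (toℕ c₂)

  suited : ∃[ k ] Suits S₁ S₂ (resolution k)
  suited = sparse-profiles-suited
    S₁ (sparse-weaken h (profile-sparse {δ} (toℕ c₀) (toℕ c₁)))
    S₂ (sparse-weaken h (profile-sparse {δ} (toℕ c₀) (toℕ c₂)))

  avoiding-block-not-monochromatic : ∀ t → Avoids S₁ S₂ t → NotMono (colour δ h (col3 c₀ c₁ c₂)) (toBlock t)
  avoiding-block-not-monochromatic (a , b , e) avoids (same₀₁ , same₁₂) =
    avoids ( offset-∈-profile {δ} {toℕ c₀} {toℕ c₁} a b same₀₁
           , offset-∈-profile {δ} {toℕ c₀} {toℕ c₂} a e (trans same₀₁ same₁₂))

  not-all-equal⇒offset₀₀∉ : ¬ (c₀ ≡ c₁ × c₁ ≡ c₂) → ¬ (offset 0F 0F ∈ S₁ × offset 0F 0F ∈ S₂)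
  not-all-equal⇒offset₀₀∉ not-all-equal (∈S₁ , ∈S₂) = not-all-equal (c₀≡c₁ , trans (sym c₀≡c₁) c₀≡c₂)
    where
    c₀≡c₁ : c₀ ≡ c₁
    c₀≡c₁ = offset₀₀-∈-profile⇒≡ c₀ c₁ ∈S₁
    c₀≡c₂ : c₀ ≡ c₂
    c₀≡c₂ = offset₀₀-∈-profile⇒≡ c₀ c₂ ∈S₂

lemma5p4 : (δ : ℕ) → (h : 4 ≤ δ) → (c₀ c₁ c₂ : Fin δ) →
    Σ Resolvable3GDD (λ D →
      IsColouring (colour δ h (col3 c₀ c₁ c₂)) (blocks D) ×
      (¬ ((c₀ ≡ c₁) × (c₁ ≡ c₂)) →
        ((zero , zero) , (zero , suc zero) , (zero , suc (suc zero))) ∈Blocks blocks D))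
lemma5p4 δ h c₀ c₁ c₂ with Profiles.suited h c₀ c₁ c₂
... | k , avoiding , centred =
  toGDD R (resolution-valid k) ,
  All-blocksOf R (All.map (avoiding-block-not-monochromatic _) avoiding) ,
  λ not-all-equal → Any-blocksOf R (Any.map (λ { refl → ∈B-toBlock 0F 0F 0F })
                                            (centred (not-all-equal⇒offset₀₀∉ not-all-equal)))
  where
  open Profiles h c₀ c₁ c₂
  R : Resolution
  R = resolution k
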